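{- Suppose $k<n/10$, $\alpha<1/100$, and $2i+b\le 2k$ (non-negative integers). Then \[q(k,i,b,n)\le q(k,i,n)\,20^{ -b}\,4^{k-i}.\]
   Context: Fix $\alpha\in(0,1)$ with $\alpha n$ an integer. For a fixed $A\subseteq[n]$ with $|A|=2k$: $q(k,i,b,n)$ is the probability that a uniformly random matching of size $\alpha n$ on $[n]$ has exactly $i$ edges with both endpoints in $A$ and exactly $b$ edges with exactly one endpoint in $A$; $q(k,i,n)=q(k,i,0,n)$. -}

module Defs where

open import Data.Bool using (Bool; true; false; _∧_; _xor_; if_then_else_)
open import Data.Nat using (ℕ; zero; suc; _≡ᵇ_; _^_; _<ᵇ_)
open import Data.Nat.Properties using (m^n≢0)
open import Data.Fin using (Fin; toℕ)
open import Data.Fin.Subset using (Subset)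
open import Data.Vec using (lookup)
open import Data.List using (List; []; _∷_; _++_; map; filter; length; concatMap; allFin)
open import Data.Bool.ListAction using (any)
open import Data.Product using (_×_; _,_)
open import Data.Integer using (+_)
open import Data.Rational using (ℚ; 0ℚ; _/_)
open import Relation.Nullary.Decidable using (does; T?)
open import Data.Bool using (T)

sublists : {A : Set} → List A → List (List A)
sublists []       = [] ∷ []
sublists (x ∷ xs) = sublists xs ++ map (x ∷_) (sublists xs)

edges : (n : ℕ) → List (Fin n × Fin n)
edges n = concatMap (λ a → concatMap (λ b → if toℕ a <ᵇ toℕ b then (a , b) ∷ [] else []) (allFin n)) (allFin n)

endpoints : {n : ℕ} → List (Fin n × Fin n) → List (Fin n)
endpoints = concatMap (λ { (a , b) → a ∷ b ∷ [] })

distinct : {n : ℕ} → List (Fin n) → Bool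
distinct []       = true
distinct (x ∷ xs) = (if any (λ y → toℕ x ≡ᵇ toℕ y) xs then false else true) ∧ distinct xs

isMatching : {n : ℕ} → List (Fin n × Fin n) → Bool
isMatching M = distinct (endpoints M)

-- All matchings of size m on [n] (each matching listed exactly once, as a set of edges).
matchings : (n m : ℕ) → List (List (Fin n × Fin n))
matchings n m = filter (λ M → T? (isMatching M ∧ (length M ≡ᵇ m))) (sublists (edges n))

insideEdges : {n : ℕ} → Subset n → List (Fin n × Fin n) → ℕ
insideEdges A M = length (filter (λ { (a , b) → T? (lookup A a ∧ lookup A b) }) M)

crossEdges : {n : ℕ} → Subset n → List (Fin n × Fin n) → ℕ
crossEdges A M = length (filter (λ { (a , b) → T? (lookup A a xor lookup A b) }) M)

prob : {X : Set} → (X → Bool) → List X → ℚ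
prob P xs with length xs
... | zero  = 0ℚ
... | suc t = (+ length (filter (λ x → T? (P x)) xs)) / suc t

-- q(k,i,b,n) for the fixed set A ⊆ [n] (|A| = 2k) and matching size m = αn:
-- probability that a uniform random matching of size m on [n] has exactly i edges
-- inside A and exactly b edges with exactly one endpoint in A.
q : (n m : ℕ) (A : Subset n) (i b : ℕ) → ℚ
q n m A i b = prob (λ M → (insideEdges A M ≡ᵇ i) ∧ (crossEdges A M ≡ᵇ b)) (matchings n m)

inv20^ : ℕ → ℚ
inv20^ b = (+ 1) / (20 ^ b)
  where instance _ = m^n≢0 20 b

pow4 : ℕ → ℚ
pow4 j = (+ (4 ^ j)) / 1

module Submission where

-- Let X_b be the matchings of size m with i edges inside A and b crossing A.
-- Switching: from x ∈ X_(b+1), a crossing edge {a,o} of x (a ∈ A, o ∉ A) and a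
-- vertex w ∉ A uncovered by x, replace {a,o} by {o,w}.  The result y lies in
-- X_b, leaves a uncovered and has {o,w} as an edge outside A; the triple is
-- recovered from (y, the ordered pair (o,w), a).  Hence
--     (b+1) (n - 2k - 2m) |X_(b+1)|  ≤  2m (2k - 2i - b) |X_b| ,
-- and as n - 2k - 2m ≥ 40m, iterating gives 20^b |X_b| ≤ C(2(k-i),b) |X_0|
-- ≤ 4^(k-i) |X_0|.

open import Defs
open import Data.Nat using (ℕ; _+_; _*_; _∸_; _≤_; _<_)
open import Data.Fin.Subset using (Subset; ∣_∣)
open import Data.Integer using (+_)
open import Data.Rational using (ℚ; _/_; 0ℚ)
open import Data.Rational renaming (_*_ to _*ℚ_; _≤_ to _≤ℚ_; _<_ to _<ℚ_) using ()
open import Relation.Binary.PropositionalEquality using (_≡_)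

open import Data.Nat using (zero; suc; z≤n; s≤s; _^_; _≡ᵇ_; _<ᵇ_; _<?_; NonZero; >-nonZero) renaming (_≟_ to _≟ℕ_)
open import Data.Nat.Properties
open import Data.Bool using (Bool; true; false; _∧_; _∨_; not; if_then_else_; T; _xor_)
import Data.Bool.Properties as Bool
open import Data.Fin using (Fin; toℕ)
import Data.Fin as Fin
open import Data.Fin.Properties using (toℕ-injective)
open import Data.Vec using (lookup; []; _∷_)
open import Data.List using (List; []; _∷_; map; filter; length; concatMap; allFin; tabulate)
open import Data.List.Properties using (length-map; length-++; length-tabulate)
import Data.List.Properties as List
open import Data.List.Membership.Propositional using (_∈_; _∉_; find; lose)
open import Data.List.Membership.Propositional.Properties
  using (∈-filter⁺; ∈-filter⁻; ∈-++⁺ˡ; ∈-++⁺ʳ; ∈-++⁻; ∈-map⁺; ∈-map⁻;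
         ∈-concatMap⁺; ∈-concatMap⁻; ∈-allFin)
open import Data.List.Relation.Unary.Any using (here; there; any?)
open import Data.List.Relation.Unary.All using ([]; _∷_)
import Data.List.Relation.Unary.All as All
open import Data.List.Relation.Unary.AllPairs using ([]; _∷_)
open import Data.List.Relation.Unary.Unique.Propositional using (Unique)
import Data.List.Relation.Unary.Unique.Propositional.Properties as Unique
open import Data.Bool.ListAction using (any)
open import Data.Product using (_×_; _,_; proj₁; proj₂)
import Data.Product.Properties as Product
open import Data.Sum using (inj₁; inj₂)
open import Data.Empty using (⊥; ⊥-elim)
open import Relation.Nullary using (¬_; yes; no; does)
open import Relation.Nullary.Decidable using (T?; map′)
open import Relation.Unary using (Pred; Decidable)
open import Relation.Binary.Definitions using (DecidableEquality)
open import Relation.Binary.PropositionalEquality using (refl; sym; trans; cong; cong₂; subst; subst₂; _≢_; module ≡-Reasoning)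
open import Function using (Equivalence)
open import Data.Nat.Tactic.RingSolver using (solve-∀)
open import Data.Integer using (ℤ; +≤+)
import Data.Integer as ℤ
import Data.Integer.Properties as ℤ
open import Data.Rational using (toℚᵘ)
import Data.Rational.Properties as ℚ
import Data.Rational.Unnormalised as ℚᵘ
import Data.Rational.Unnormalised.Properties as ℚᵘ

T⇒≡ : ∀ {b} → T b → b ≡ true
T⇒≡ = Equivalence.to Bool.T-≡

≡⇒T : ∀ {b} → b ≡ true → T b
≡⇒T = Equivalence.from Bool.T-≡

true≢false : true ≢ false
true≢false ()

∧-true : ∀ {p q} → p ∧ q ≡ true → p ≡ true × q ≡ true
∧-true {true} {true} _ = refl , refl

not-true : ∀ {p} → not p ≡ true → p ≡ false
not-true {false} _ = refl

𝟙 : Bool → ℕ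
𝟙 true = 1
𝟙 false = 0

𝟙≤1 : ∀ b → 𝟙 b ≤ 1
𝟙≤1 true = s≤s z≤n
𝟙≤1 false = z≤n

sumOver : {A : Set} → (A → ℕ) → List A → ℕ
sumOver f [] = 0
sumOver f (x ∷ xs) = f x + sumOver f xs

count : {A : Set} → (A → Bool) → List A → ℕ
count p = sumOver (λ x → 𝟙 (p x))

select : {A : Set} → (A → Bool) → List A → List A
select p = filter (λ x → T? (p x))

module Counting {A : Set} where

  sum-cong : ∀ {f g : A → ℕ} xs → (∀ x → x ∈ xs → f x ≡ g x) → sumOver f xs ≡ sumOver g xs
  sum-cong [] h = refl
  sum-cong (x ∷ xs) h = cong₂ _+_ (h x (here refl)) (sum-cong xs (λ y y∈ → h y (there y∈)))

  sum-mono : ∀ {f g : A → ℕ} xs → (∀ x → x ∈ xs → f x ≤ g x) → sumOver f xs ≤ sumOver g xs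
  sum-mono [] h = z≤n
  sum-mono (x ∷ xs) h = +-mono-≤ (h x (here refl)) (sum-mono xs (λ y y∈ → h y (there y∈)))

  sum-+ : ∀ (f g : A → ℕ) xs → sumOver (λ x → f x + g x) xs ≡ sumOver f xs + sumOver g xs
  sum-+ f g [] = refl
  sum-+ f g (x ∷ xs) rewrite sum-+ f g xs = interchange (f x) (g x) (sumOver f xs) (sumOver g xs)
    where
    interchange : ∀ a b c d → a + b + (c + d) ≡ a + c + (b + d)
    interchange = solve-∀

  sum-const : ∀ c (xs : List A) → sumOver (λ _ → c) xs ≡ c * length xs
  sum-const c [] = sym (*-zeroʳ c)
  sum-const c (x ∷ xs) rewrite sum-const c xs = sym (*-suc c (length xs))

  sum-*ˡ : ∀ c (f : A → ℕ) xs → c * sumOver f xs ≡ sumOver (λ x → c * f x) xs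
  sum-*ˡ c f [] = *-zeroʳ c
  sum-*ˡ c f (x ∷ xs) rewrite *-distribˡ-+ c (f x) (sumOver f xs) | sum-*ˡ c f xs = refl

  count-ones : (xs : List A) → sumOver (λ _ → 1) xs ≡ length xs
  count-ones xs = trans (sum-const 1 xs) (*-identityˡ (length xs))

  length-filter : ∀ {ℓ} {P : Pred A ℓ} (P? : Decidable P) xs → length (filter P? xs) ≡ count (λ x → does (P? x)) xs
  length-filter P? [] = refl
  length-filter P? (x ∷ xs) with does (P? x)
  ... | true = cong suc (length-filter P? xs)
  ... | false = length-filter P? xs

  length-select : ∀ (p : A → Bool) xs → length (select p xs) ≡ count p xs
  length-select p = length-filter (λ x → T? (p x))

  count-select : ∀ (q p : A → Bool) xs → count q (select p xs) ≡ count (λ x → q x ∧ p x) xs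
  count-select q p [] = refl
  count-select q p (x ∷ xs) with p x
  ... | true rewrite Bool.∧-identityʳ (q x) = cong (_+_ (𝟙 (q x))) (count-select q p xs)
  ... | false rewrite Bool.∧-zeroʳ (q x) = count-select q p xs

  count-split : ∀ (p q : A → Bool) xs → count (λ x → p x ∧ q x) xs + count (λ x → p x ∧ not (q x)) xs ≡ count p xs
  count-split p q xs = trans (sym (sum-+ _ _ xs)) (sum-cong xs (λ x _ → split (p x) (q x)))
    where
    split : ∀ p q → 𝟙 (p ∧ q) + 𝟙 (p ∧ not q) ≡ 𝟙 p
    split true true = refl
    split true false = refl
    split false q = refl

  count≤length : ∀ (p : A → Bool) xs → count p xs ≤ length xs
  count≤length p [] = z≤n
  count≤length p (x ∷ xs) = +-mono-≤ (𝟙≤1 (p x)) (count≤length p xs)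

  count-pos : ∀ (p : A → Bool) {x} xs → x ∈ xs → p x ≡ true → 1 ≤ count p xs
  count-pos p (y ∷ xs) (here refl) eq rewrite eq = s≤s z≤n
  count-pos p (y ∷ xs) (there x∈) eq = ≤-trans (count-pos p xs x∈ eq) (m≤n+m _ (𝟙 (p y)))

  ∈-select : ∀ (p : A → Bool) {x} xs → x ∈ xs → p x ≡ true → x ∈ select p xs
  ∈-select p xs x∈ eq = ∈-filter⁺ (λ x → T? (p x)) x∈ (≡⇒T eq)

  select-∈ : ∀ (p : A → Bool) {x} xs → x ∈ select p xs → x ∈ xs × p x ≡ true
  select-∈ p xs x∈ with ∈-filter⁻ (λ x → T? (p x)) x∈
  ... | x∈' , t = x∈' , T⇒≡ t

  select-cong : ∀ (p q : A → Bool) xs → (∀ x → x ∈ xs → p x ≡ q x) → select p xs ≡ select q xs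
  select-cong p q [] h = refl
  select-cong p q (x ∷ xs) h with p x in e1 | q x in e2
  ... | true | true = cong (x ∷_) (select-cong p q xs (λ y y∈ → h y (there y∈)))
  ... | false | false = select-cong p q xs (λ y y∈ → h y (there y∈))
  ... | true | false = ⊥-elim (true≢false (trans (sym e1) (trans (h x (here refl)) e2)))
  ... | false | true = ⊥-elim (true≢false (trans (sym e2) (trans (sym (h x (here refl))) e1)))

  length-concatMap : ∀ {B : Set} (f : A → List B) xs → length (concatMap f xs) ≡ sumOver (λ x → length (f x)) xs
  length-concatMap f [] = refl
  length-concatMap f (x ∷ xs) rewrite length-++ (f x) {concatMap f xs} | length-concatMap f xs = refl

open Counting public

sum-swap : ∀ {A B : Set} (f : A → B → ℕ) xs ys →
           sumOver (λ x → sumOver (f x) ys) xs ≡ sumOver (λ y → sumOver (λ x → f x y) xs) ys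
sum-swap f [] ys = sym (sum-zero ys)
  where
  sum-zero : ∀ ys → sumOver (λ _ → 0) ys ≡ 0
  sum-zero [] = refl
  sum-zero (y ∷ ys) = sum-zero ys
sum-swap f (x ∷ xs) ys rewrite sum-swap f xs ys = sym (sum-+ (f x) (λ y → sumOver (λ x → f x y) xs) ys)

length-pairs : ∀ {B D : Set} (C : List B) (L : List D) → length (concatMap (λ c → map (c ,_) L) C) ≡ length L * length C
length-pairs C L = begin
  length (concatMap (λ c → map (c ,_) L) C)   ≡⟨ length-concatMap _ C ⟩
  sumOver (λ c → length (map (c ,_) L)) C     ≡⟨ sum-cong C (λ c _ → length-map (c ,_) L) ⟩
  sumOver (λ _ → length L) C                  ≡⟨ sum-const (length L) C ⟩
  length L * length C                         ∎
  where open ≡-Reasoning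

unique-concatMap : ∀ {A B : Set} (key : B → A) (f : A → List B) xs → Unique xs →
  (∀ x → x ∈ xs → Unique (f x)) → (∀ x y → y ∈ f x → key y ≡ x) → Unique (concatMap f xs)
unique-concatMap key f [] u hu hk = []
unique-concatMap key f (x ∷ xs) (x∉ ∷ u) hu hk =
  Unique.++⁺ (hu x (here refl)) (unique-concatMap key f xs u (λ z z∈ → hu z (there z∈)) hk) disjoint
  where
  disjoint : ∀ {v} → ¬ (v ∈ f x × v ∈ concatMap f xs)
  disjoint {v} (v∈ , v∈') with find (∈-concatMap⁻ f {xs = xs} v∈')
  ... | z , z∈ , v∈z = All.lookup x∉ z∈ (trans (sym (hk x v v∈)) (hk z v v∈z))

module DecEq {A : Set} (_≟_ : DecidableEquality A) where

  eq : A → A → Bool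
  eq x y = does (x ≟ y)

  eq-refl : ∀ x → eq x x ≡ true
  eq-refl x with x ≟ x
  ... | yes _ = refl
  ... | no x≢x = ⊥-elim (x≢x refl)

  eq-true : ∀ {x y} → eq x y ≡ true → x ≡ y
  eq-true {x} {y} e with x ≟ y
  ... | yes x≡y = x≡y

  eq-false : ∀ {x y} → x ≢ y → eq x y ≡ false
  eq-false {x} {y} x≢y with x ≟ y
  ... | yes x≡y = ⊥-elim (x≢y x≡y)
  ... | no _ = refl

  eq-sym : ∀ x y → eq x y ≡ eq y x
  eq-sym x y with x ≟ y | y ≟ x
  ... | yes _ | yes _ = refl
  ... | no _ | no _ = refl
  ... | yes x≡y | no y≢x = ⊥-elim (y≢x (sym x≡y))
  ... | no x≢y | yes y≡x = ⊥-elim (x≢y (sym y≡x))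

  mem : A → List A → Bool
  mem x [] = false
  mem x (y ∷ ys) = eq x y ∨ mem x ys

  ∈⇒mem : ∀ {x ys} → x ∈ ys → mem x ys ≡ true
  ∈⇒mem {x} (here refl) rewrite eq-refl x = refl
  ∈⇒mem {x} {y ∷ ys} (there x∈) rewrite ∈⇒mem x∈ = Bool.∨-zeroʳ (eq x y)

  mem⇒∈ : ∀ {x} ys → mem x ys ≡ true → x ∈ ys
  mem⇒∈ {x} (y ∷ ys) e with x ≟ y
  ... | yes refl = here refl
  ... | no _ = there (mem⇒∈ ys e)

  ∉⇒mem : ∀ {x ys} → x ∉ ys → mem x ys ≡ false
  ∉⇒mem {x} {ys} x∉ with mem x ys in e
  ... | true = ⊥-elim (x∉ (mem⇒∈ ys e))
  ... | false = refl

  count-eq-∉ : ∀ (q : A → Bool) {y} L → y ∉ L → count (λ e → eq e y ∧ q e) L ≡ 0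
  count-eq-∉ q [] y∉ = refl
  count-eq-∉ q {y} (x ∷ L) y∉ rewrite eq-false {x} {y} (λ x≡y → y∉ (here (sym x≡y))) =
    count-eq-∉ q L (λ y∈ → y∉ (there y∈))

  count-eq-∈ : ∀ (q : A → Bool) {y} L → Unique L → y ∈ L → count (λ e → eq e y ∧ q e) L ≡ 𝟙 (q y)
  count-eq-∈ q (x ∷ L) (x∉ ∷ u) (here refl)
    rewrite eq-refl x | count-eq-∉ q L (λ x∈ → All.lookup x∉ x∈ refl) = +-identityʳ _
  count-eq-∈ q {y} (x ∷ L) (x∉ ∷ u) (there y∈)
    rewrite eq-false {x} {y} (All.lookup x∉ y∈) = count-eq-∈ q L u y∈

  private
    ∧true : ∀ y L → count (λ e → eq e y) L ≡ count (λ e → eq e y ∧ true) L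
    ∧true y L = sum-cong L (λ e _ → cong 𝟙 (sym (Bool.∧-identityʳ (eq e y))))

  count-eq≤1 : ∀ y L → Unique L → count (λ e → eq e y) L ≤ 1
  count-eq≤1 y L u with any? (y ≟_) L
  ... | yes y∈ = ≤-reflexive (trans (∧true y L) (count-eq-∈ (λ _ → true) L u y∈))
  ... | no y∉ = ≤-trans (≤-reflexive (trans (∧true y L) (count-eq-∉ (λ _ → true) L y∉))) z≤n

  -- A duplicate-free list contained in U is no longer than U: count the
  -- pairs (x , u) with x ∈ L, u ∈ U, x = u in both orders.
  unique-⊆⇒length≤ : ∀ L U → Unique L → (∀ x → x ∈ L → x ∈ U) → length L ≤ length U
  unique-⊆⇒length≤ L U u L⊆U = begin
    length L                                   ≡⟨ count-ones L ⟨
    sumOver (λ _ → 1) L                        ≤⟨ sum-mono L (λ x x∈ → at-least-one x (L⊆U x x∈)) ⟩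
    sumOver (λ x → sumOver (λ v → 𝟙 (eq v x)) U) L  ≡⟨ sum-swap (λ x v → 𝟙 (eq v x)) L U ⟩
    sumOver (λ v → sumOver (λ x → 𝟙 (eq v x)) L) U  ≤⟨ sum-mono U (λ v _ → at-most-one v) ⟩
    sumOver (λ _ → 1) U                        ≡⟨ count-ones U ⟩
    length U                                   ∎
    where
    open ≤-Reasoning
    at-least-one : ∀ x → x ∈ U → 1 ≤ sumOver (λ v → 𝟙 (eq v x)) U
    at-least-one x x∈U = count-pos (λ v → eq v x) U x∈U (eq-refl x)
    at-most-one : ∀ v → sumOver (λ x → 𝟙 (eq v x)) L ≤ 1
    at-most-one v = ≤-trans (≤-reflexive (sum-cong L (λ x _ → cong 𝟙 (eq-sym v x)))) (count-eq≤1 v L u)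

  -- Sublists of a duplicate-free list E model the subsets of E; each subset
  -- is recovered from its membership test by filtering E (sublist-select).
  sublist-⊆ : ∀ (E : List A) {s y} → s ∈ sublists E → y ∈ s → y ∈ E
  sublist-⊆ [] (here refl) ()
  sublist-⊆ (h ∷ E) {s} s∈ y∈ with ∈-++⁻ (sublists E) s∈
  ... | inj₁ s∈' = there (sublist-⊆ E s∈' y∈)
  ... | inj₂ s∈' with ∈-map⁻ (h ∷_) s∈'
  ... | s' , s'∈ , refl with y∈
  ... | here refl = here refl
  ... | there y∈' = there (sublist-⊆ E s'∈ y∈')

  select-sublist : ∀ (p : A → Bool) E → select p E ∈ sublists E
  select-sublist p [] = here refl
  select-sublist p (h ∷ E) with p h
  ... | true = ∈-++⁺ʳ (sublists E) (∈-map⁺ (h ∷_) (select-sublist p E))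
  ... | false = ∈-++⁺ˡ (select-sublist p E)

  unique-sublists : ∀ E → Unique E → Unique (sublists E)
  unique-sublists [] u = [] ∷ []
  unique-sublists (h ∷ E) (h∉ ∷ u) =
    Unique.++⁺ (unique-sublists E u) (Unique.map⁺ ∷-injective (unique-sublists E u)) disjoint
    where
    ∷-injective : ∀ {a b : List A} → h ∷ a ≡ h ∷ b → a ≡ b
    ∷-injective refl = refl
    disjoint : ∀ {v} → ¬ (v ∈ sublists E × v ∈ map (h ∷_) (sublists E))
    disjoint (v∈ , v∈') with ∈-map⁻ (h ∷_) v∈'
    ... | s' , _ , refl = All.lookup h∉ (sublist-⊆ E v∈ (here refl)) refl

  unique-sublist : ∀ E {s} → Unique E → s ∈ sublists E → Unique s
  unique-sublist [] u (here refl) = []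
  unique-sublist (h ∷ E) {s} (h∉ ∷ u) s∈ with ∈-++⁻ (sublists E) s∈
  ... | inj₁ s∈' = unique-sublist E u s∈'
  ... | inj₂ s∈' with ∈-map⁻ (h ∷_) s∈'
  ... | s' , s'∈ , refl =
        All.tabulate (λ y∈ → All.lookup h∉ (sublist-⊆ E s'∈ y∈)) ∷ unique-sublist E u s'∈

  mem-select : ∀ (p : A → Bool) E {f} → f ∈ E → mem f (select p E) ≡ p f
  mem-select p E {f} f∈ with p f in e
  ... | true = ∈⇒mem (∈-select p E f∈ e)
  ... | false = ∉⇒mem (λ f∈' → true≢false (trans (sym (proj₂ (select-∈ p E f∈'))) e))

  sublist-select : ∀ E {s} → Unique E → s ∈ sublists E → select (λ f → mem f s) E ≡ s
  sublist-select [] u (here refl) = refl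
  sublist-select (h ∷ E) {s} (h∉ ∷ u) s∈ with ∈-++⁻ (sublists E) s∈
  ... | inj₁ s∈' rewrite ∉⇒mem {h} {s} (λ h∈ → All.lookup h∉ (sublist-⊆ E s∈' h∈) refl) =
        sublist-select E u s∈'
  ... | inj₂ s∈' with ∈-map⁻ (h ∷_) s∈'
  ... | s' , s'∈ , refl rewrite eq-refl h = cong (h ∷_) (begin
        select (λ f → eq f h ∨ mem f s') E  ≡⟨ select-cong _ _ E (λ f f∈ → cong (_∨ mem f s') (f≢h f∈)) ⟩
        select (λ f → mem f s') E           ≡⟨ sublist-select E u s'∈ ⟩
        s'                                  ∎)
    where
    open ≡-Reasoning
    f≢h : ∀ {f} → f ∈ E → eq f h ≡ false
    f≢h f∈ = eq-false (λ f≡h → All.lookup h∉ f∈ (sym f≡h))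

  exchange : List A → List A → A → A → List A
  exchange E x d e = select (λ f → (mem f x ∧ not (eq f d)) ∨ eq f e) E

  module Exchange (E : List A) (uE : Unique E) {x d e}
                  (x⊆E : x ∈ sublists E) (d∈x : d ∈ x) (e∈E : e ∈ E) (e∉x : e ∉ x) where

    private
      d∈ : ∀ f → eq f d ≡ true → mem f x ≡ true
      d∈ f p rewrite eq-true {f} {d} p = ∈⇒mem d∈x
      e∉ : ∀ f → eq f e ≡ true → mem f x ≡ false
      e∉ f p rewrite eq-true {f} {e} p = ∉⇒mem e∉x

      pointwise-count : ∀ q M D Ee → (D ≡ true → M ≡ true) → (Ee ≡ true → M ≡ false) →
        𝟙 (q ∧ ((M ∧ not D) ∨ Ee)) + 𝟙 (D ∧ q) ≡ 𝟙 (q ∧ M) + 𝟙 (Ee ∧ q)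
      pointwise-count true true true true _ e∉ with e∉ refl
      ... | ()
      pointwise-count true true true false _ _ = refl
      pointwise-count true true false true _ e∉ with e∉ refl
      ... | ()
      pointwise-count true true false false _ _ = refl
      pointwise-count true false true Ee d∈ _ with d∈ refl
      ... | ()
      pointwise-count true false false true _ _ = refl
      pointwise-count true false false false _ _ = refl
      pointwise-count false M D Ee _ _ rewrite Bool.∧-zeroʳ D | Bool.∧-zeroʳ Ee = refl

      pointwise-back : ∀ M D Ee → (D ≡ true → M ≡ true) → (Ee ≡ true → M ≡ false) →
        ((((M ∧ not D) ∨ Ee) ∧ not Ee) ∨ D) ≡ M
      pointwise-back true true true _ e∉ with e∉ refl
      ... | ()
      pointwise-back true true false _ _ = refl
      pointwise-back true false true _ e∉ with e∉ refl
      ... | ()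
      pointwise-back true false false _ _ = refl
      pointwise-back false true Ee d∈ _ with d∈ refl
      ... | ()
      pointwise-back false false true _ _ = refl
      pointwise-back false false false _ _ = refl

    exchange-count : ∀ (q : A → Bool) → count q (exchange E x d e) + 𝟙 (q d) ≡ count q x + 𝟙 (q e)
    exchange-count q = begin
      count q (exchange E x d e) + 𝟙 (q d)
        ≡⟨ cong₂ _+_ (count-select q _ E) (sym (count-eq-∈ q E uE (sublist-⊆ E x⊆E d∈x))) ⟩
      count (λ f → q f ∧ ((mem f x ∧ not (eq f d)) ∨ eq f e)) E + count (λ f → eq f d ∧ q f) E
        ≡⟨ sym (sum-+ _ _ E) ⟩
      sumOver (λ f → 𝟙 (q f ∧ ((mem f x ∧ not (eq f d)) ∨ eq f e)) + 𝟙 (eq f d ∧ q f)) E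
        ≡⟨ sum-cong E (λ f _ → pointwise-count (q f) (mem f x) (eq f d) (eq f e) (d∈ f) (e∉ f)) ⟩
      sumOver (λ f → 𝟙 (q f ∧ mem f x) + 𝟙 (eq f e ∧ q f)) E
        ≡⟨ sum-+ _ _ E ⟩
      count (λ f → q f ∧ mem f x) E + count (λ f → eq f e ∧ q f) E
        ≡⟨ cong₂ _+_ (trans (sym (count-select q _ E)) (cong (count q) (sublist-select E uE x⊆E)))
                     (count-eq-∈ q E uE e∈E) ⟩
      count q x + 𝟙 (q e) ∎
      where open ≡-Reasoning

    exchange-back : exchange E (exchange E x d e) e d ≡ x
    exchange-back = trans
      (select-cong _ _ E (λ f f∈ →
        trans (cong (λ z → (z ∧ not (eq f e)) ∨ eq f d) (mem-select _ E f∈))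
              (pointwise-back (mem f x) (eq f d) (eq f e) (d∈ f) (e∉ f))))
      (sublist-select E uE x⊆E)

    exchange-∋ : e ∈ exchange E x d e
    exchange-∋ = ∈-select _ E e∈E (trans (cong ((mem e x ∧ not (eq e d)) ∨_) (eq-refl e)) (Bool.∨-zeroʳ _))

module Graph (n : ℕ) where

  Vertex : Set
  Vertex = Fin n

  Edge : Set
  Edge = Vertex × Vertex

  _≟V_ : DecidableEquality Vertex
  a ≟V b = map′ toℕ-injective (cong toℕ) (toℕ a ≟ℕ toℕ b)

  _≟E_ : DecidableEquality Edge
  _≟E_ = Product.≡-dec _≟V_ _≟V_

  module V = DecEq _≟V_
  module E = DecEq _≟E_
  open V using () renaming (eq to _==_)

  Vertices : List Vertex
  Vertices = allFin n

  unique-Vertices : Unique Vertices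
  unique-Vertices = Unique.allFin⁺ n

  Edges : List Edge
  Edges = edges n

  private
    singleton-∈ : ∀ c (a b : Vertex) {y} → y ∈ (if c then (a , b) ∷ [] else []) → y ≡ (a , b) × c ≡ true
    singleton-∈ true a b (here refl) = refl , refl

  <⇒∈Edges : ∀ (a b : Vertex) → toℕ a < toℕ b → (a , b) ∈ Edges
  <⇒∈Edges a b a<b = ∈-concatMap⁺ _ (lose (∈-allFin a) (∈-concatMap⁺ _ (lose (∈-allFin b) inner)))
    where
    inner : (a , b) ∈ (if toℕ a <ᵇ toℕ b then (a , b) ∷ [] else [])
    inner rewrite T⇒≡ (<⇒<ᵇ a<b) = here refl

  ∈Edges⇒< : ∀ {e} → e ∈ Edges → toℕ (proj₁ e) < toℕ (proj₂ e)
  ∈Edges⇒< {e} e∈ with find (∈-concatMap⁻ _ {xs = allFin n} e∈)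
  ... | a , _ , e∈a with find (∈-concatMap⁻ _ {xs = allFin n} e∈a)
  ... | b , _ , e∈b with singleton-∈ (toℕ a <ᵇ toℕ b) a b e∈b
  ... | refl , c = <ᵇ⇒< _ _ (≡⇒T c)

  unique-Edges : Unique Edges
  unique-Edges = unique-concatMap proj₁ _ (allFin n) unique-Vertices
    (λ a _ → unique-concatMap proj₂ _ (allFin n) unique-Vertices (λ b _ → singleton (toℕ a <ᵇ toℕ b) a b)
               (λ b y y∈ → cong proj₂ (proj₁ (singleton-∈ _ a b y∈))))
    first
    where
    singleton : ∀ c (a b : Vertex) → Unique (if c then (a , b) ∷ [] else [])
    singleton true a b = [] ∷ []
    singleton false a b = []
    first : ∀ a y → y ∈ concatMap (λ b → if toℕ a <ᵇ toℕ b then (a , b) ∷ [] else []) (allFin n) → proj₁ y ≡ a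
    first a y y∈ with find (∈-concatMap⁻ _ {xs = allFin n} y∈)
    ... | b , _ , y∈b = cong proj₁ (proj₁ (singleton-∈ _ a b y∈b))

  Loopless : List Edge → Set
  Loopless M = ∀ e → e ∈ M → proj₁ e ≢ proj₂ e

  sublist-loopless : ∀ {x} → x ∈ sublists Edges → Loopless x
  sublist-loopless x∈ e e∈ p = <⇒≢ (∈Edges⇒< (E.sublist-⊆ Edges x∈ e∈)) (cong toℕ p)

  touches : Vertex → Edge → Bool
  touches v e = (v == proj₁ e) ∨ (v == proj₂ e)

  deg : List Edge → Vertex → ℕ
  deg x v = count (touches v) x

  deg-pos : ∀ x v {e} → e ∈ x → touches v e ≡ true → 1 ≤ deg x v
  deg-pos x v e∈ t = count-pos (touches v) x e∈ t

  private
    𝟙-∨ : ∀ p q → (p ≡ true → q ≡ true → ⊥) → 𝟙 (p ∨ q) ≡ 𝟙 p + 𝟙 q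
    𝟙-∨ true true h = ⊥-elim (h refl refl)
    𝟙-∨ true false h = refl
    𝟙-∨ false q h = refl

  incidences : ∀ (q : Vertex → Bool) (a b : Vertex) → a ≢ b →
               sumOver (λ v → 𝟙 (touches v (a , b) ∧ q v)) Vertices ≡ 𝟙 (q a) + 𝟙 (q b)
  incidences q a b a≢b = trans (sum-cong Vertices (λ v _ → split v (q v)))
    (trans (sum-+ _ _ Vertices)
           (cong₂ _+_ (V.count-eq-∈ q Vertices unique-Vertices (∈-allFin a))
                      (V.count-eq-∈ q Vertices unique-Vertices (∈-allFin b))))
    where
    split : ∀ v r → 𝟙 (((v == a) ∨ (v == b)) ∧ r) ≡ 𝟙 ((v == a) ∧ r) + 𝟙 ((v == b) ∧ r)
    split v r with v == a in e1 | v == b in e2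
    ... | true | true = ⊥-elim (a≢b (trans (sym (V.eq-true {v} {a} e1)) (V.eq-true {v} {b} e2)))
    ... | true | false = sym (+-identityʳ _)
    ... | false | _ = refl

  sum-deg : ∀ x → Loopless x → sumOver (deg x) Vertices ≡ 2 * length x
  sum-deg x nl = begin
    sumOver (deg x) Vertices                                         ≡⟨ sum-swap (λ v e → 𝟙 (touches v e)) Vertices x ⟩
    sumOver (λ e → sumOver (λ v → 𝟙 (touches v e)) Vertices) x     ≡⟨ sum-cong x each ⟩
    sumOver (λ _ → 2) x                                              ≡⟨ sum-const 2 x ⟩
    2 * length x                                                     ∎
    where
    open ≡-Reasoning
    each : ∀ e → e ∈ x → sumOver (λ v → 𝟙 (touches v e)) Vertices ≡ 2
    each e e∈ = trans (sum-cong Vertices (λ v _ → cong 𝟙 (sym (Bool.∧-identityʳ (touches v e)))))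
                      (incidences (λ _ → true) (proj₁ e) (proj₂ e) (nl e e∈))

  private
    any-false⇒count0 : ∀ {B : Set} (p : B → Bool) xs → any p xs ≡ false → count p xs ≡ 0
    any-false⇒count0 p [] e = refl
    any-false⇒count0 p (x ∷ xs) e with p x
    ... | false = any-false⇒count0 p xs e

    count0⇒any-false : ∀ {B : Set} (p : B → Bool) xs → count p xs ≡ 0 → any p xs ≡ false
    count0⇒any-false p [] e = refl
    count0⇒any-false p (x ∷ xs) e with p x
    ... | false = count0⇒any-false p xs e

    if-not : ∀ b → (if b then false else true) ≡ not b
    if-not true = refl
    if-not false = refl

  distinct⇒occurs≤1 : ∀ (L : List Vertex) → distinct L ≡ true → ∀ v → count (_== v) L ≤ 1
  distinct⇒occurs≤1 [] d v = z≤n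
  distinct⇒occurs≤1 (x ∷ xs) d v with any (λ y → toℕ x ≡ᵇ toℕ y) xs in e1 | distinct xs in e2
  distinct⇒occurs≤1 (x ∷ xs) () v | true | _
  distinct⇒occurs≤1 (x ∷ xs) () v | false | false
  ... | false | true with x == v in e3
  ... | false = distinct⇒occurs≤1 xs e2 v
  ... | true rewrite V.eq-true {x} {v} e3 =
        s≤s (≤-reflexive (trans (sum-cong xs (λ u _ → cong 𝟙 (V.eq-sym u v))) (any-false⇒count0 _ xs e1)))

  occurs≤1⇒distinct : ∀ (L : List Vertex) → (∀ v → count (_== v) L ≤ 1) → distinct L ≡ true
  occurs≤1⇒distinct [] h = refl
  occurs≤1⇒distinct (x ∷ xs) h =
    cong₂ _∧_ (trans (if-not _) (cong not (count0⇒any-false _ xs x∉xs)))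
              (occurs≤1⇒distinct xs (λ v → ≤-trans (m≤n+m _ (𝟙 (x == v))) (h v)))
    where
    x-once : 1 + count (_== x) xs ≤ 1
    x-once = subst (λ z → 𝟙 z + count (_== x) xs ≤ 1) (V.eq-refl x) (h x)
    x∉xs : count (x ==_) xs ≡ 0
    x∉xs = trans (sum-cong xs (λ u _ → cong 𝟙 (V.eq-sym x u))) (n≤0⇒n≡0 (≤-pred x-once))

  occurs-endpoints : ∀ (M : List Edge) → Loopless M → ∀ v → count (_== v) (endpoints M) ≡ deg M v
  occurs-endpoints [] nl v = refl
  occurs-endpoints ((a , b) ∷ M) nl v = begin
    𝟙 (a == v) + (𝟙 (b == v) + count (_== v) (endpoints M))
      ≡⟨ cong (λ z → 𝟙 (a == v) + (𝟙 (b == v) + z)) (occurs-endpoints M (λ e e∈ → nl e (there e∈)) v) ⟩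
    𝟙 (a == v) + (𝟙 (b == v) + deg M v)
      ≡⟨ sym (+-assoc (𝟙 (a == v)) _ _) ⟩
    𝟙 (a == v) + 𝟙 (b == v) + deg M v
      ≡⟨ cong (_+ deg M v) (cong₂ _+_ (cong 𝟙 (V.eq-sym a v)) (cong 𝟙 (V.eq-sym b v))) ⟩
    𝟙 (v == a) + 𝟙 (v == b) + deg M v
      ≡⟨ cong (_+ deg M v) (sym (𝟙-∨ (v == a) (v == b) not-both)) ⟩
    𝟙 (touches v (a , b)) + deg M v ∎
    where
    open ≡-Reasoning
    not-both : v == a ≡ true → v == b ≡ true → ⊥
    not-both p q = nl (a , b) (here refl) (trans (sym (V.eq-true {v} {a} p)) (V.eq-true {v} {b} q))

  matching⇒deg≤1 : ∀ M → Loopless M → isMatching M ≡ true → ∀ v → deg M v ≤ 1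
  matching⇒deg≤1 M nl im v = subst (_≤ 1) (occurs-endpoints M nl v) (distinct⇒occurs≤1 (endpoints M) im v)

  deg≤1⇒matching : ∀ M → Loopless M → (∀ v → deg M v ≤ 1) → isMatching M ≡ true
  deg≤1⇒matching M nl h = occurs≤1⇒distinct (endpoints M) (λ v → subst (_≤ 1) (sym (occurs-endpoints M nl v)) (h v))

  record IsMatching (m : ℕ) (x : List Edge) : Set where
    field
      ⊆Edges   : x ∈ sublists Edges
      matching : isMatching x ≡ true
      size     : length x ≡ m

  ∈matchings⇒ : ∀ {m x} → x ∈ matchings n m → IsMatching m x
  ∈matchings⇒ {m} {x} x∈ with select-∈ (λ M → isMatching M ∧ (length M ≡ᵇ m)) (sublists Edges) x∈
  ... | x∈' , p with isMatching x in im | length x ≡ᵇ m in e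
  ... | true | true = record { ⊆Edges = x∈' ; matching = im ; size = ≡ᵇ⇒≡ (length x) m (≡⇒T e) }

  ⇒∈matchings : ∀ {m x} → IsMatching m x → x ∈ matchings n m
  ⇒∈matchings {m} {x} record { ⊆Edges = x∈ ; matching = im ; size = lx } =
    ∈-select (λ M → isMatching M ∧ (length M ≡ᵇ m)) (sublists Edges) x∈
             (cong₂ _∧_ im (T⇒≡ (≡⇒≡ᵇ (length x) m lx)))

count-Subset : ∀ {k m} (B : Subset k) (g : Fin k → Fin m) (p : Fin m → Bool) →
               (∀ i → p (g i) ≡ lookup B i) → count p (tabulate g) ≡ ∣ B ∣
count-Subset [] g p h = refl
count-Subset (true ∷ B) g p h rewrite h Fin.zero =
  cong suc (count-Subset B (λ i → g (Fin.suc i)) p (λ i → h (Fin.suc i)))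
count-Subset (false ∷ B) g p h rewrite h Fin.zero =
  count-Subset B (λ i → g (Fin.suc i)) p (λ i → h (Fin.suc i))

module Relative (n : ℕ) (A : Subset n) where

  open Graph n

  inA : Vertex → Bool
  inA v = lookup A v

  count-inA : count inA Vertices ≡ ∣ A ∣
  count-inA = count-Subset A (λ i → i) inA (λ i → refl)

  count-notA : count (λ v → not (inA v)) Vertices ≡ n ∸ ∣ A ∣
  count-notA = begin
    count (λ v → not (inA v)) Vertices                               ≡⟨ m+n∸n≡m _ ∣ A ∣ ⟨
    count (λ v → not (inA v)) Vertices + ∣ A ∣ ∸ ∣ A ∣               ≡⟨ cong (λ z → z ∸ ∣ A ∣) complement ⟩
    n ∸ ∣ A ∣                                                        ∎
    where
    open ≡-Reasoning
    complement : count (λ v → not (inA v)) Vertices + ∣ A ∣ ≡ n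
    complement = begin
      count (λ v → not (inA v)) Vertices + ∣ A ∣          ≡⟨ +-comm _ ∣ A ∣ ⟩
      ∣ A ∣ + count (λ v → not (inA v)) Vertices
        ≡⟨ cong (λ z → z + count (λ v → not (inA v)) Vertices) (sym count-inA) ⟩
      count inA Vertices + count (λ v → not (inA v)) Vertices ≡⟨ count-split (λ _ → true) inA Vertices ⟩
      count (λ _ → true) Vertices                         ≡⟨ count-ones Vertices ⟩
      length Vertices                                     ≡⟨ length-tabulate (λ i → i) ⟩
      n                                                   ∎

  inside crossing outside : Edge → Bool
  inside e = inA (proj₁ e) ∧ inA (proj₂ e)
  crossing e = inA (proj₁ e) xor inA (proj₂ e)
  outside e = not (inA (proj₁ e)) ∧ not (inA (proj₂ e))

  insideEdges≡ : ∀ x → insideEdges A x ≡ count inside x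
  insideEdges≡ x = trans (length-filter _ x) (sum-cong x (λ { (a , b) _ → refl }))

  crossEdges≡ : ∀ x → crossEdges A x ≡ count crossing x
  crossEdges≡ x = trans (length-filter _ x) (sum-cong x (λ { (a , b) _ → refl }))

  isolated : List Edge → Vertex → Bool
  isolated x v = deg x v ≡ᵇ 0

  freeOutside freeInside : List Edge → List Vertex
  freeOutside x = select (λ v → not (inA v) ∧ isolated x v) Vertices
  freeInside x = select (λ v → inA v ∧ isolated x v) Vertices

  many-freeOutside : ∀ x → Loopless x → n ∸ ∣ A ∣ ≤ length (freeOutside x) + 2 * length x
  many-freeOutside x nl = begin
    n ∸ ∣ A ∣                               ≡⟨ count-notA ⟨
    count (λ v → not (inA v)) Vertices      ≡⟨ count-split (λ v → not (inA v)) (isolated x) Vertices ⟨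
    count (λ v → not (inA v) ∧ isolated x v) Vertices + count (λ v → not (inA v) ∧ not (isolated x v)) Vertices
      ≤⟨ +-mono-≤ (≤-reflexive (sym (length-select _ Vertices)))
                  (sum-mono Vertices (λ v _ → covered≤deg (not (inA v)) (deg x v))) ⟩
    length (freeOutside x) + sumOver (deg x) Vertices ≡⟨ cong (_+_ (length (freeOutside x))) (sum-deg x nl) ⟩
    length (freeOutside x) + 2 * length x   ∎
    where
    open ≤-Reasoning
    covered≤deg : ∀ p d → 𝟙 (p ∧ not (d ≡ᵇ 0)) ≤ d
    covered≤deg p zero rewrite Bool.∧-zeroʳ p = z≤n
    covered≤deg p (suc d) rewrite Bool.∧-identityʳ p = ≤-trans (𝟙≤1 p) (s≤s z≤n)

  covered-inA : ∀ y → Loopless y → (∀ v → deg y v ≤ 1) →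
                count (λ v → inA v ∧ not (isolated y v)) Vertices ≡ 2 * count inside y + count crossing y
  covered-inA y nl deg≤1 = begin
    count (λ v → inA v ∧ not (isolated y v)) Vertices
      ≡⟨ sum-cong Vertices (λ v _ → covered (inA v) (deg y v) (deg≤1 v)) ⟩
    sumOver (λ v → 𝟙 (inA v) * deg y v) Vertices
      ≡⟨ sum-cong Vertices (λ v _ → sum-*ˡ (𝟙 (inA v)) (λ e → 𝟙 (touches v e)) y) ⟩
    sumOver (λ v → sumOver (λ e → 𝟙 (inA v) * 𝟙 (touches v e)) y) Vertices
      ≡⟨ sum-cong Vertices (λ v _ → sum-cong y (λ e _ → 𝟙-* (inA v) (touches v e))) ⟩
    sumOver (λ v → sumOver (λ e → 𝟙 (touches v e ∧ inA v)) y) Vertices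
      ≡⟨ sum-swap (λ v e → 𝟙 (touches v e ∧ inA v)) Vertices y ⟩
    sumOver (λ e → sumOver (λ v → 𝟙 (touches v e ∧ inA v)) Vertices) y
      ≡⟨ sum-cong y (λ e e∈ → incidences inA (proj₁ e) (proj₂ e) (nl e e∈)) ⟩
    sumOver (λ e → 𝟙 (inA (proj₁ e)) + 𝟙 (inA (proj₂ e))) y
      ≡⟨ sum-cong y (λ e _ → endpoints-inA (inA (proj₁ e)) (inA (proj₂ e))) ⟩
    sumOver (λ e → 2 * 𝟙 (inside e) + 𝟙 (crossing e)) y
      ≡⟨ sum-+ _ _ y ⟩
    sumOver (λ e → 2 * 𝟙 (inside e)) y + count crossing y
      ≡⟨ cong (_+ count crossing y) (sum-*ˡ 2 (λ e → 𝟙 (inside e)) y) ⟨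
    2 * count inside y + count crossing y ∎
    where
    open ≡-Reasoning
    covered : ∀ p d → d ≤ 1 → 𝟙 (p ∧ not (d ≡ᵇ 0)) ≡ 𝟙 p * d
    covered p zero _ rewrite Bool.∧-zeroʳ p = sym (*-zeroʳ (𝟙 p))
    covered p (suc zero) _ rewrite Bool.∧-identityʳ p = sym (*-identityʳ (𝟙 p))
    covered p (suc (suc d)) (s≤s ())
    𝟙-* : ∀ a b → 𝟙 a * 𝟙 b ≡ 𝟙 (b ∧ a)
    𝟙-* true true = refl
    𝟙-* true false = refl
    𝟙-* false true = refl
    𝟙-* false false = refl
    endpoints-inA : ∀ a b → 𝟙 a + 𝟙 b ≡ 2 * 𝟙 (a ∧ b) + 𝟙 (a xor b)
    endpoints-inA true true = refl
    endpoints-inA true false = refl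
    endpoints-inA false true = refl
    endpoints-inA false false = refl

  freeInside-size : ∀ y → Loopless y → (∀ v → deg y v ≤ 1) →
                    length (freeInside y) + (2 * count inside y + count crossing y) ≡ ∣ A ∣
  freeInside-size y nl deg≤1 = begin
    length (freeInside y) + (2 * count inside y + count crossing y)
      ≡⟨ cong₂ _+_ (length-select _ Vertices) (sym (covered-inA y nl deg≤1)) ⟩
    count (λ v → inA v ∧ isolated y v) Vertices + count (λ v → inA v ∧ not (isolated y v)) Vertices
      ≡⟨ count-split inA (isolated y) Vertices ⟩
    count inA Vertices ≡⟨ count-inA ⟩
    ∣ A ∣ ∎
    where open ≡-Reasoning

module Switching (n : ℕ) (A : Subset n) where

  open Graph n
  open Relative n A
  open V using () renaming (eq to _==_)
  open E using (exchange)

  X : ℕ → ℕ → ℕ → List (List Edge)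
  X m i b = select (λ M → (insideEdges A M ≡ᵇ i) ∧ (crossEdges A M ≡ᵇ b)) (matchings n m)

  record InX (m i b : ℕ) (x : List Edge) : Set where
    field
      sizedMatching : IsMatching m x
      #inside     : count inside x ≡ i
      #crossing   : count crossing x ≡ b
    open IsMatching sizedMatching public

    loopless : Loopless x
    loopless = sublist-loopless ⊆Edges

    deg≤1 : ∀ v → deg x v ≤ 1
    deg≤1 = matching⇒deg≤1 x loopless matching

  ∈X⇒ : ∀ {m i b x} → x ∈ X m i b → InX m i b x
  ∈X⇒ {m} {i} {b} {x} x∈ with select-∈ _ (matchings n m) x∈
  ... | x∈M , p with ∧-true {insideEdges A x ≡ᵇ i} p
  ... | p₁ , p₂ = record
    { sizedMatching = ∈matchings⇒ x∈M
    ; #inside = trans (sym (insideEdges≡ x)) (≡ᵇ⇒≡ _ _ (≡⇒T p₁))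
    ; #crossing = trans (sym (crossEdges≡ x)) (≡ᵇ⇒≡ _ _ (≡⇒T p₂)) }

  ⇒∈X : ∀ {m i b x} → InX m i b x → x ∈ X m i b
  ⇒∈X {m} {i} {b} {x} x∈ = ∈-select _ (matchings n m) (⇒∈matchings sizedMatching)
    (cong₂ _∧_ (T⇒≡ (≡⇒≡ᵇ _ _ (trans (insideEdges≡ x) #inside)))
               (T⇒≡ (≡⇒≡ᵇ _ _ (trans (crossEdges≡ x) #crossing))))
    where open InX x∈

  unique-X : ∀ m i b → Unique (X m i b)
  unique-X m i b = Unique.filter⁺ _ (Unique.filter⁺ _ (E.unique-sublists Edges unique-Edges))

  inEnd outEnd : Edge → Vertex
  inEnd c = if inA (proj₁ c) then proj₁ c else proj₂ c
  outEnd c = if inA (proj₁ c) then proj₂ c else proj₁ c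

  edgeBetween : Vertex → Vertex → Edge
  edgeBetween o w = if toℕ o <ᵇ toℕ w then (o , w) else (w , o)

  inEnd-inA : ∀ c → crossing c ≡ true → inA (inEnd c) ≡ true
  inEnd-inA c crossing-c with inA (proj₁ c) in e₁ | inA (proj₂ c) in e₂
  inEnd-inA c _ | true | false = e₁
  inEnd-inA c _ | false | true = e₂
  inEnd-inA c () | true | true
  inEnd-inA c () | false | false

  outEnd-notA : ∀ c → crossing c ≡ true → inA (outEnd c) ≡ false
  outEnd-notA c crossing-c with inA (proj₁ c) in e₁ | inA (proj₂ c) in e₂
  outEnd-notA c _ | true | false = e₂
  outEnd-notA c _ | false | true = e₁
  outEnd-notA c () | true | true
  outEnd-notA c () | false | false

  crossing⇒¬inside : ∀ c → crossing c ≡ true → inside c ≡ false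
  crossing⇒¬inside c crossing-c with inA (proj₁ c) | inA (proj₂ c)
  crossing⇒¬inside c _ | true | false = refl
  crossing⇒¬inside c _ | false | _ = refl
  crossing⇒¬inside c () | true | true

  touches-inEnd : ∀ c → touches (inEnd c) c ≡ true
  touches-inEnd c with inA (proj₁ c)
  ... | true rewrite V.eq-refl (proj₁ c) = refl
  ... | false rewrite V.eq-refl (proj₂ c) = Bool.∨-zeroʳ _

  touches-outEnd : ∀ c → touches (outEnd c) c ≡ true
  touches-outEnd c with inA (proj₁ c)
  ... | false rewrite V.eq-refl (proj₁ c) = refl
  ... | true rewrite V.eq-refl (proj₂ c) = Bool.∨-zeroʳ _

  edgeBetween-ends : ∀ c → toℕ (proj₁ c) < toℕ (proj₂ c) → edgeBetween (inEnd c) (outEnd c) ≡ c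
  edgeBetween-ends c lt with inA (proj₁ c)
  ... | true rewrite T⇒≡ (<⇒<ᵇ lt) = refl
  ... | false with toℕ (proj₂ c) <ᵇ toℕ (proj₁ c) in e
  ... | true = ⊥-elim (<-asym lt (<ᵇ⇒< _ _ (≡⇒T e)))
  ... | false = refl

  touches-edgeBetween : ∀ v o w → touches v (edgeBetween o w) ≡ ((v == o) ∨ (v == w))
  touches-edgeBetween v o w with toℕ o <ᵇ toℕ w
  ... | true = refl
  ... | false = Bool.∨-comm (v == w) (v == o)

  edgeBetween-∈Edges : ∀ o w → o ≢ w → edgeBetween o w ∈ Edges
  edgeBetween-∈Edges o w o≢w with toℕ o <ᵇ toℕ w in e
  ... | true = <⇒∈Edges o w (<ᵇ⇒< _ _ (≡⇒T e))
  ... | false = <⇒∈Edges w o (≤∧≢⇒< (≮⇒≥ (λ o<w → true≢false (trans (sym (T⇒≡ (<⇒<ᵇ o<w))) e)))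
                                        (λ w≡o → o≢w (toℕ-injective (sym w≡o))))

  module _ (o w : Vertex) (o∉A : inA o ≡ false) (w∉A : inA w ≡ false) where

    edgeBetween-outside : outside (edgeBetween o w) ≡ true
    edgeBetween-outside with toℕ o <ᵇ toℕ w
    ... | true rewrite o∉A | w∉A = refl
    ... | false rewrite o∉A | w∉A = refl

    edgeBetween-¬inside : inside (edgeBetween o w) ≡ false
    edgeBetween-¬inside with toℕ o <ᵇ toℕ w
    ... | true rewrite o∉A = refl
    ... | false rewrite w∉A = refl

    edgeBetween-¬crossing : crossing (edgeBetween o w) ≡ false
    edgeBetween-¬crossing with toℕ o <ᵇ toℕ w
    ... | true rewrite o∉A | w∉A = refl
    ... | false rewrite o∉A | w∉A = refl

  -- Triples (x, crossing edge c of x, free vertex w ∉ A) with x ∈ X_(b+1), and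
  -- quadruples (y, oriented outside edge (o , w) of y, free vertex a ∈ A) with y ∈ X_b.
  Triple Quadruple : Set
  Triple = List Edge × (Edge × Vertex)
  Quadruple = List Edge × (Vertex × (Vertex × Vertex))

  pairsAt : List Edge → List (Edge × Vertex)
  pairsAt x = concatMap (λ c → map (c ,_) (freeOutside x)) (select crossing x)

  Triples : ℕ → ℕ → ℕ → List Triple
  Triples m i b = concatMap (λ x → map (x ,_) (pairsAt x)) (X m i (suc b))

  orientations : List Edge → Edge → Vertex → List Quadruple
  orientations y e a = (y , proj₁ e , proj₂ e , a) ∷ (y , proj₂ e , proj₁ e , a) ∷ []

  Quadruples : ℕ → ℕ → ℕ → List Quadruple
  Quadruples m i b = concatMap (λ y → concatMap (λ e → concatMap (orientations y e) (freeInside y)) (select outside y))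
                               (X m i b)

  switch : Triple → Quadruple
  switch (x , c , w) = (exchange Edges x c (edgeBetween (outEnd c) w) , outEnd c , w , inEnd c)

  unswitch : Quadruple → Triple
  unswitch (y , o , w , a) = (exchange Edges y (edgeBetween o w) (edgeBetween a o) , edgeBetween a o , w)

  module Switch {m i b x c w} (x∈X : x ∈ X m i (suc b)) (c∈ : c ∈ select crossing x)
                (w∈ : w ∈ freeOutside x) where

    private
      module x = InX (∈X⇒ x∈X)

      c∈x : c ∈ x
      c∈x = proj₁ (select-∈ crossing x c∈)
      crossing-c : crossing c ≡ true
      crossing-c = proj₂ (select-∈ crossing x c∈)

      w-free : not (inA w) ∧ isolated x w ≡ true
      w-free = proj₂ (select-∈ _ Vertices w∈)
      w∉A : inA w ≡ false
      w∉A = not-true (proj₁ (∧-true w-free))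
      deg-w : deg x w ≡ 0
      deg-w = ≡ᵇ⇒≡ _ _ (≡⇒T (proj₂ (∧-true {not (inA w)} w-free)))

    a o : Vertex
    a = inEnd c
    o = outEnd c

    private
      o∉A : inA o ≡ false
      o∉A = outEnd-notA c crossing-c
      a∈A : inA a ≡ true
      a∈A = inEnd-inA c crossing-c

      o≢w : o ≢ w
      o≢w o≡w = 1+n≰n (≤-trans (subst (λ z → 1 ≤ deg x z) o≡w (deg-pos x o c∈x (touches-outEnd c))) (≤-reflexive deg-w))

    e′ : Edge
    e′ = edgeBetween o w

    private
      w-touches-e′ : touches w e′ ≡ true
      w-touches-e′ = trans (touches-edgeBetween w o w) (trans (cong ((w == o) ∨_) (V.eq-refl w)) (Bool.∨-zeroʳ _))

      e′∉x : e′ ∉ x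
      e′∉x e′∈ = 1+n≰n (≤-trans (deg-pos x w e′∈ w-touches-e′) (≤-reflexive deg-w))

      open E.Exchange Edges unique-Edges x.⊆Edges c∈x (edgeBetween-∈Edges o w o≢w) e′∉x

    y : List Edge
    y = exchange Edges x c e′

    deg-shift : ∀ v → deg y v + 𝟙 (touches v c) ≡ deg x v + 𝟙 (touches v e′)
    deg-shift v = exchange-count (touches v)

    y-deg≤1 : ∀ v → deg y v ≤ 1
    y-deg≤1 v with touches v e′ in v-e′ | v == o in v-o | v == w in v-w
    ... | false | _ | _ = begin
      deg y v                           ≤⟨ m≤m+n (deg y v) _ ⟩
      deg y v + 𝟙 (touches v c)         ≡⟨ deg-shift v ⟩
      deg x v + 𝟙 (touches v e′)        ≡⟨ cong (λ z → deg x v + 𝟙 z) v-e′ ⟩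
      deg x v + 0                       ≡⟨ +-identityʳ _ ⟩
      deg x v                           ≤⟨ x.deg≤1 v ⟩
      1                                 ∎
      where open ≤-Reasoning
    ... | true | true | _ rewrite V.eq-true {v} {o} v-o = begin
      deg y o                           ≡⟨ +-cancelʳ-≡ _ _ _ (trans (cong (λ z → deg y o + 𝟙 z) (sym (touches-outEnd c)))
                                                                    (trans (deg-shift o) (cong (λ z → deg x o + 𝟙 z) v-e′))) ⟩
      deg x o                           ≤⟨ x.deg≤1 o ⟩
      1                                 ∎
      where open ≤-Reasoning
    ... | true | false | true rewrite V.eq-true {v} {w} v-w = begin
      deg y w                           ≤⟨ m≤m+n (deg y w) _ ⟩
      deg y w + 𝟙 (touches w c)         ≡⟨ deg-shift w ⟩
      deg x w + 𝟙 (touches w e′)        ≡⟨ cong₂ (λ d t → d + 𝟙 t) deg-w v-e′ ⟩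
      1                                 ∎
      where open ≤-Reasoning
    ... | true | false | false =
      ⊥-elim (true≢false (trans (sym v-e′) (trans (touches-edgeBetween v o w) (cong₂ _∨_ v-o v-w))))

    y-size : length y ≡ m
    y-size = begin
      length y                   ≡⟨ count-ones y ⟨
      count (λ _ → true) y       ≡⟨ +-cancelʳ-≡ _ _ _ (exchange-count (λ _ → true)) ⟩
      count (λ _ → true) x       ≡⟨ count-ones x ⟩
      length x                   ≡⟨ x.size ⟩
      m                          ∎
      where open ≡-Reasoning

    y-inside : count inside y ≡ i
    y-inside = begin
      count inside y                   ≡⟨ +-identityʳ _ ⟨
      count inside y + 0               ≡⟨ cong (λ z → count inside y + 𝟙 z) (crossing⇒¬inside c crossing-c) ⟨
      count inside y + 𝟙 (inside c)    ≡⟨ exchange-count inside ⟩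
      count inside x + 𝟙 (inside e′)   ≡⟨ cong (λ z → count inside x + 𝟙 z) (edgeBetween-¬inside o w o∉A w∉A) ⟩
      count inside x + 0               ≡⟨ +-identityʳ _ ⟩
      count inside x                   ≡⟨ x.#inside ⟩
      i                                ∎
      where open ≡-Reasoning

    y-crossing : count crossing y ≡ b
    y-crossing = suc-injective (begin
      suc (count crossing y)             ≡⟨ +-comm 1 _ ⟩
      count crossing y + 1               ≡⟨ cong (λ z → count crossing y + 𝟙 z) crossing-c ⟨
      count crossing y + 𝟙 (crossing c)  ≡⟨ exchange-count crossing ⟩
      count crossing x + 𝟙 (crossing e′) ≡⟨ cong (λ z → count crossing x + 𝟙 z) (edgeBetween-¬crossing o w o∉A w∉A) ⟩
      count crossing x + 0               ≡⟨ +-identityʳ _ ⟩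
      count crossing x                   ≡⟨ x.#crossing ⟩
      suc b                              ∎)
      where open ≡-Reasoning

    y∈X : y ∈ X m i b
    y∈X = ⇒∈X record
      { sizedMatching = record
        { ⊆Edges = y⊆Edges
        ; matching = deg≤1⇒matching y (sublist-loopless y⊆Edges) y-deg≤1
        ; size = y-size }
      ; #inside = y-inside
      ; #crossing = y-crossing }
      where
      y⊆Edges : y ∈ sublists Edges
      y⊆Edges = E.select-sublist _ Edges

    a-free : a ∈ freeInside y
    a-free = ∈-select _ Vertices (∈-allFin a) (cong₂ _∧_ a∈A (T⇒≡ (≡⇒≡ᵇ _ _ deg-a)))
      where
      a-misses-e′ : touches a e′ ≡ false
      a-misses-e′ = trans (touches-edgeBetween a o w) (cong₂ _∨_ (a≢ o o∉A) (a≢ w w∉A))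
        where
        a≢ : ∀ u → inA u ≡ false → (a == u) ≡ false
        a≢ u u∉A = V.eq-false (λ a≡u → true≢false (trans (sym a∈A) (trans (cong inA a≡u) u∉A)))
      deg-a : deg y a ≡ 0
      deg-a = n≤0⇒n≡0 (≤-pred (begin
        suc (deg y a)                  ≡⟨ +-comm 1 _ ⟩
        deg y a + 1                    ≡⟨ cong (λ z → deg y a + 𝟙 z) (touches-inEnd c) ⟨
        deg y a + 𝟙 (touches a c)      ≡⟨ deg-shift a ⟩
        deg x a + 𝟙 (touches a e′)     ≡⟨ cong (λ z → deg x a + 𝟙 z) a-misses-e′ ⟩
        deg x a + 0                    ≡⟨ +-identityʳ _ ⟩
        deg x a                        ≤⟨ x.deg≤1 a ⟩
        1                              ∎))
        where open ≤-Reasoning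

    e′-outside : e′ ∈ select outside y
    e′-outside = ∈-select outside y exchange-∋ (edgeBetween-outside o w o∉A w∉A)

    switch∈Quadruples : switch (x , c , w) ∈ Quadruples m i b
    switch∈Quadruples =
      ∈-concatMap⁺ _ (lose y∈X (∈-concatMap⁺ _ (lose e′-outside (∈-concatMap⁺ _ (lose a-free oriented)))))
      where
      oriented : (y , o , w , a) ∈ orientations y e′ a
      oriented with toℕ o <ᵇ toℕ w
      ... | true = here refl
      ... | false = there (here refl)

    unswitch∘switch : unswitch (switch (x , c , w)) ≡ (x , c , w)
    unswitch∘switch rewrite edgeBetween-ends c (∈Edges⇒< (E.sublist-⊆ Edges x.⊆Edges c∈x)) =
      cong (λ z → z , c , w) exchange-back

  private
    _≟T_ : DecidableEquality Triple
    _≟T_ = Product.≡-dec (List.≡-dec _≟E_) (Product.≡-dec _≟E_ _≟V_)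

    map-pair-first : ∀ {B C : Set} (x : B) (L : List C) y → y ∈ map (x ,_) L → proj₁ y ≡ x
    map-pair-first x L y y∈ with ∈-map⁻ (x ,_) y∈
    ... | _ , _ , refl = refl

    unique-map-pair : ∀ {B C : Set} (x : B) {L : List C} → Unique L → Unique (map (x ,_) L)
    unique-map-pair x u = Unique.map⁺ (λ { refl → refl }) u

  unique-Triples : ∀ m i b → Unique (Triples m i b)
  unique-Triples m i b = unique-concatMap proj₁ _ (X m i (suc b)) (unique-X m i (suc b))
    (λ x x∈ → unique-map-pair x
      (unique-concatMap proj₁ _ (select crossing x)
        (Unique.filter⁺ _ (E.unique-sublist Edges unique-Edges (InX.⊆Edges (∈X⇒ x∈))))
        (λ c _ → unique-map-pair c (Unique.filter⁺ _ unique-Vertices))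
        (λ c → map-pair-first c _)))
    (λ x → map-pair-first x _)

  Triples⊆ : ∀ m i b t → t ∈ Triples m i b → t ∈ map unswitch (Quadruples m i b)
  Triples⊆ m i b t t∈ with find (∈-concatMap⁻ _ {xs = X m i (suc b)} t∈)
  ... | x , x∈ , t∈x with ∈-map⁻ (x ,_) t∈x
  ... | p , p∈ , refl with find (∈-concatMap⁻ _ {xs = select crossing x} p∈)
  ... | c , c∈ , p∈c with ∈-map⁻ (c ,_) p∈c
  ... | w , w∈ , refl = subst (_∈ map unswitch (Quadruples m i b)) (Switch.unswitch∘switch x∈ c∈ w∈)
                              (∈-map⁺ unswitch (Switch.switch∈Quadruples x∈ c∈ w∈))

  #Triples≤#Quadruples : ∀ m i b → length (Triples m i b) ≤ length (Quadruples m i b)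
  #Triples≤#Quadruples m i b = begin
    length (Triples m i b)                    ≤⟨ T.unique-⊆⇒length≤ _ _ (unique-Triples m i b) (Triples⊆ m i b) ⟩
    length (map unswitch (Quadruples m i b))  ≡⟨ length-map unswitch (Quadruples m i b) ⟩
    length (Quadruples m i b)                 ∎
    where
    open ≤-Reasoning
    module T = DecEq _≟T_

  #Triples≥ : ∀ m i b → ((n ∸ ∣ A ∣) ∸ 2 * m) * suc b * length (X m i (suc b)) ≤ length (Triples m i b)
  #Triples≥ m i b = begin
    K * length (X m i (suc b))              ≡⟨ sum-const K (X m i (suc b)) ⟨
    sumOver (λ _ → K) (X m i (suc b))       ≤⟨ sum-mono (X m i (suc b)) per-matching ⟩
    sumOver (λ x → length (triplesAt x)) (X m i (suc b)) ≡⟨ length-concatMap triplesAt (X m i (suc b)) ⟨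
    length (Triples m i b)                  ∎
    where
    open ≤-Reasoning
    K : ℕ
    K = ((n ∸ ∣ A ∣) ∸ 2 * m) * suc b
    triplesAt : List Edge → List Triple
    triplesAt x = map (x ,_) (pairsAt x)
    per-matching : ∀ x → x ∈ X m i (suc b) → K ≤ length (triplesAt x)
    per-matching x x∈ = begin
      ((n ∸ ∣ A ∣) ∸ 2 * m) * suc b                        ≤⟨ *-monoˡ-≤ (suc b) enough-free ⟩
      length (freeOutside x) * suc b                       ≡⟨ cong (_*_ (length (freeOutside x))) #crossing ⟨
      length (freeOutside x) * length (select crossing x)  ≡⟨ length-pairs (select crossing x) (freeOutside x) ⟨
      length (pairsAt x)                                   ≡⟨ length-map (x ,_) (pairsAt x) ⟨
      length (triplesAt x)                                 ∎
      where
      module x = InX (∈X⇒ x∈)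
      #crossing : length (select crossing x) ≡ suc b
      #crossing = trans (length-select crossing x) x.#crossing
      enough-free : (n ∸ ∣ A ∣) ∸ 2 * m ≤ length (freeOutside x)
      enough-free = begin
        (n ∸ ∣ A ∣) ∸ 2 * m                        ≤⟨ ∸-monoˡ-≤ (2 * m) covered≤2m ⟩
        (length (freeOutside x) + 2 * m) ∸ 2 * m   ≡⟨ m+n∸n≡m (length (freeOutside x)) (2 * m) ⟩
        length (freeOutside x)                     ∎
        where
        covered≤2m : n ∸ ∣ A ∣ ≤ length (freeOutside x) + 2 * m
        covered≤2m = subst (λ z → n ∸ ∣ A ∣ ≤ length (freeOutside x) + 2 * z) x.size (many-freeOutside x x.loopless)

  #Quadruples≤ : ∀ m i b → length (Quadruples m i b) ≤ (2 * (∣ A ∣ ∸ (2 * i + b))) * m * length (X m i b)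
  #Quadruples≤ m i b = begin
    length (Quadruples m i b)              ≡⟨ length-concatMap quadruplesAt (X m i b) ⟩
    sumOver (λ y → length (quadruplesAt y)) (X m i b) ≤⟨ sum-mono (X m i b) per-matching ⟩
    sumOver (λ _ → K) (X m i b)            ≡⟨ sum-const K (X m i b) ⟩
    K * length (X m i b)                   ∎
    where
    open ≤-Reasoning
    K : ℕ
    K = (2 * (∣ A ∣ ∸ (2 * i + b))) * m
    quadruplesAt : List Edge → List Quadruple
    quadruplesAt y = concatMap (λ e → concatMap (orientations y e) (freeInside y)) (select outside y)
    per-matching : ∀ y → y ∈ X m i b → length (quadruplesAt y) ≤ K
    per-matching y y∈ = begin
      length (quadruplesAt y)                                ≡⟨ length-concatMap _ (select outside y) ⟩
      sumOver (λ e → length (concatMap (orientations y e) (freeInside y))) (select outside y)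
        ≡⟨ sum-cong (select outside y) (λ e _ → trans (length-concatMap _ (freeInside y)) (sum-const 2 (freeInside y))) ⟩
      sumOver (λ e → 2 * length (freeInside y)) (select outside y) ≡⟨ sum-const _ (select outside y) ⟩
      (2 * length (freeInside y)) * length (select outside y)
        ≤⟨ *-mono-≤ (≤-reflexive (cong (2 *_) #free)) (≤-trans (≤-reflexive (length-select outside y))
                                                     (≤-trans (count≤length outside y) (≤-reflexive y.size))) ⟩
      K                                                      ∎
      where
      module y = InX (∈X⇒ y∈)
      #free : length (freeInside y) ≡ ∣ A ∣ ∸ (2 * i + b)
      #free = begin-equality
        length (freeInside y)                                     ≡⟨ m+n∸n≡m _ (2 * i + b) ⟨
        length (freeInside y) + (2 * i + b) ∸ (2 * i + b)         ≡⟨ cong (λ z → length (freeInside y) + z ∸ (2 * i + b))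
                                                                       (cong₂ (λ u v → 2 * u + v) y.#inside y.#crossing) ⟨
        length (freeInside y) + (2 * count inside y + count crossing y) ∸ (2 * i + b)
                                                                  ≡⟨ cong (_∸ (2 * i + b)) (freeInside-size y y.loopless y.deg≤1) ⟩
        ∣ A ∣ ∸ (2 * i + b)                                       ∎

  switching : ∀ m i b → ((n ∸ ∣ A ∣) ∸ 2 * m) * suc b * length (X m i (suc b))
                        ≤ (2 * (∣ A ∣ ∸ (2 * i + b))) * m * length (X m i b)
  switching m i b = ≤-trans (#Triples≥ m i b) (≤-trans (#Triples≤#Quadruples m i b) (#Quadruples≤ m i b))

choose : ℕ → ℕ → ℕ
choose n zero = 1
choose zero (suc k) = 0
choose (suc n) (suc k) = choose n k + choose n (suc k)

choose-zero : ∀ n k → n < k → choose n k ≡ 0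
choose-zero zero (suc k) _ = refl
choose-zero (suc n) (suc k) (s≤s n<k) = cong₂ _+_ (choose-zero n k n<k) (choose-zero n (suc k) (m<n⇒m<1+n n<k))

choose-one : ∀ n → choose n 1 ≡ n
choose-one zero = refl
choose-one (suc n) = cong suc (choose-one n)

choose≤2^ : ∀ n k → choose n k ≤ 2 ^ n
choose≤2^ n zero = m^n>0 2 n
choose≤2^ zero (suc k) = z≤n
choose≤2^ (suc n) (suc k) = subst (choose n k + choose n (suc k) ≤_) (cong (_+_ (2 ^ n)) (sym (+-identityʳ (2 ^ n))))
                                  (+-mono-≤ (choose≤2^ n k) (choose≤2^ n (suc k)))

choose-ratio : ∀ n k → suc k * choose n (suc k) ≡ (n ∸ k) * choose n k
choose-ratio zero k = trans (*-zeroʳ (suc k)) (sym (cong (_* choose 0 k) (0∸n≡0 k)))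
choose-ratio (suc n) zero = trans (+-identityʳ _) (trans (choose-one (suc n)) (sym (*-identityʳ (suc n))))
choose-ratio (suc n) (suc k) = +-cancelˡ-≡ (suc k * C₁) _ _ (begin
    suc k * C₁ + suc (suc k) * (C₁ + C₂)
      ≡⟨ cong (_+_ (suc k * C₁)) (*-distribˡ-+ (suc (suc k)) C₁ C₂) ⟩
    suc k * C₁ + (suc (suc k) * C₁ + suc (suc k) * C₂)
      ≡⟨ cong (λ z → suc k * C₁ + (suc (suc k) * C₁ + z)) (choose-ratio n (suc k)) ⟩
    suc k * C₁ + (suc (suc k) * C₁ + (n ∸ suc k) * C₁)
      ≡⟨ cong (_+_ (suc k * C₁)) (sym (*-distribʳ-+ C₁ (suc (suc k)) (n ∸ suc k))) ⟩
    suc k * C₁ + (suc (suc k) + (n ∸ suc k)) * C₁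
      ≡⟨ cong (_+_ (suc k * C₁)) shift ⟩
    suc k * C₁ + (suc k + (n ∸ k)) * C₁
      ≡⟨ cong (_+_ (suc k * C₁)) (*-distribʳ-+ C₁ (suc k) (n ∸ k)) ⟩
    suc k * C₁ + (suc k * C₁ + (n ∸ k) * C₁)
      ≡⟨ cong (λ z → suc k * C₁ + (z + (n ∸ k) * C₁)) (choose-ratio n k) ⟩
    suc k * C₁ + ((n ∸ k) * C₀ + (n ∸ k) * C₁)
      ≡⟨ cong (_+_ (suc k * C₁)) (sym (*-distribˡ-+ (n ∸ k) C₀ C₁)) ⟩
    suc k * C₁ + (n ∸ k) * (C₀ + C₁) ∎)
  where
  open ≡-Reasoning
  C₀ C₁ C₂ : ℕ
  C₀ = choose n k
  C₁ = choose n (suc k)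
  C₂ = choose n (suc (suc k))
  -- (k+2) + (n-k-1) = (k+1) + (n-k) when k < n; otherwise C₁ = 0.
  shift : (suc (suc k) + (n ∸ suc k)) * C₁ ≡ (suc k + (n ∸ k)) * C₁
  shift with k <? n
  ... | yes k<n = cong (_* C₁) (trans (sym (+-suc (suc k) (n ∸ suc k))) (cong (_+_ (suc k)) (sym (+-∸-assoc 1 k<n))))
  ... | no k≮n rewrite choose-zero n (suc k) (s≤s (≮⇒≥ k≮n)) =
        trans (*-zeroʳ (suc (suc k) + (n ∸ suc k))) (sym (*-zeroʳ (suc k + (n ∸ k))))

2k∸[2i+b] : ∀ k i b → 2 * k ∸ (2 * i + b) ≡ 2 * (k ∸ i) ∸ b
2k∸[2i+b] k i b = trans (sym (∸-+-assoc (2 * k) (2 * i) b)) (cong (_∸ b) (sym (*-distribˡ-∸ 2 k i)))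

iterate-ratio : ∀ (r R : ℕ) (c : ℕ → ℕ) → (∀ b → suc b * (r * c (suc b)) ≤ (R ∸ b) * c b) →
                ∀ b → r ^ b * c b ≤ choose R b * c 0
iterate-ratio r R c ratio zero = ≤-refl
iterate-ratio r R c ratio (suc b) = *-cancelˡ-≤ (suc b) (begin
  suc b * (r ^ suc b * c (suc b))  ≡⟨ reassoc₁ (suc b) r (r ^ b) (c (suc b)) ⟩
  r ^ b * (suc b * (r * c (suc b))) ≤⟨ *-monoʳ-≤ (r ^ b) (ratio b) ⟩
  r ^ b * ((R ∸ b) * c b)           ≡⟨ reassoc₂ (r ^ b) (R ∸ b) (c b) ⟩
  (R ∸ b) * (r ^ b * c b)           ≤⟨ *-monoʳ-≤ (R ∸ b) (iterate-ratio r R c ratio b) ⟩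
  (R ∸ b) * (choose R b * c 0)      ≡⟨ *-assoc (R ∸ b) (choose R b) (c 0) ⟨
  (R ∸ b) * choose R b * c 0        ≡⟨ cong (_* c 0) (choose-ratio R b) ⟨
  suc b * choose R (suc b) * c 0    ≡⟨ *-assoc (suc b) (choose R (suc b)) (c 0) ⟩
  suc b * (choose R (suc b) * c 0)  ∎)
  where
  open ≤-Reasoning
  reassoc₁ : ∀ s r p x → s * (r * p * x) ≡ p * (s * (r * x))
  reassoc₁ = solve-∀
  reassoc₂ : ∀ p d x → p * (d * x) ≡ d * (p * x)
  reassoc₂ = solve-∀

ratio-bound : ∀ N s c₁ F m c₀ → N * s * c₁ ≤ 2 * F * m * c₀ → 40 * m ≤ N → 1 ≤ N → s * (20 * c₁) ≤ F * c₀
ratio-bound N s c₁ F m c₀ switching 40m≤N 1≤N = *-cancelˡ-≤ N {{>-nonZero 1≤N}} (begin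
  N * (s * (20 * c₁))     ≡⟨ reassoc₁ N s c₁ ⟩
  20 * (N * s * c₁)       ≤⟨ *-monoʳ-≤ 20 switching ⟩
  20 * (2 * F * m * c₀)   ≡⟨ reassoc₂ F m c₀ ⟩
  (40 * m) * (F * c₀)     ≤⟨ *-monoˡ-≤ (F * c₀) 40m≤N ⟩
  N * (F * c₀)            ∎)
  where
  open ≤-Reasoning
  reassoc₁ : ∀ N s c₁ → N * (s * (20 * c₁)) ≡ 20 * (N * s * c₁)
  reassoc₁ = solve-∀
  reassoc₂ : ∀ F m c₀ → 20 * (2 * F * m * c₀) ≡ (40 * m) * (F * c₀)
  reassoc₂ = solve-∀

40m≤N : ∀ n m k → 100 * m ≤ n → 10 * k < n → 40 * m ≤ (n ∸ 2 * k) ∸ 2 * m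
40m≤N n m k 100m≤n 10k<n = begin
  40 * m                                          ≡⟨ m+n∸n≡m (40 * m) (2 * k + 2 * m) ⟨
  (40 * m + (2 * k + 2 * m)) ∸ (2 * k + 2 * m)    ≤⟨ ∸-monoˡ-≤ (2 * k + 2 * m) (subst (_≤ n) (regroup m k) 42m+2k≤n) ⟩
  n ∸ (2 * k + 2 * m)                             ≡⟨ ∸-+-assoc n (2 * k) (2 * m) ⟨
  (n ∸ 2 * k) ∸ 2 * m                             ∎
  where
  open ≤-Reasoning
  regroup : ∀ m k → 42 * m + 2 * k ≡ 40 * m + (2 * k + 2 * m)
  regroup = solve-∀
  scale : ∀ m k → 100 * (42 * m + 2 * k) ≡ 42 * (100 * m) + 20 * (10 * k)
  scale = solve-∀
  split : ∀ n → 42 * n + 20 * n + 38 * n ≡ 100 * n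
  split = solve-∀
  42m+2k≤n : 42 * m + 2 * k ≤ n
  42m+2k≤n = *-cancelˡ-≤ 100 (begin
    100 * (42 * m + 2 * k)              ≡⟨ scale m k ⟩
    42 * (100 * m) + 20 * (10 * k)      ≤⟨ +-mono-≤ (*-monoʳ-≤ 42 100m≤n) (*-monoʳ-≤ 20 (<⇒≤ 10k<n)) ⟩
    42 * n + 20 * n                     ≤⟨ m≤m+n _ (38 * n) ⟩
    42 * n + 20 * n + 38 * n            ≡⟨ split n ⟩
    100 * n                             ∎)

1≤N : ∀ n m k → 100 * m ≤ n → 10 * k < n → 1 ≤ (n ∸ 2 * k) ∸ 2 * m
1≤N n (suc m) k 100m≤n 10k<n = ≤-trans (s≤s z≤n) (40m≤N n (suc m) k 100m≤n 10k<n)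
1≤N n zero k _ 10k<n = begin
  1                    ≡⟨ m+n∸n≡m 1 (2 * k) ⟨
  (1 + 2 * k) ∸ 2 * k  ≤⟨ ∸-monoˡ-≤ (2 * k) (≤-trans (s≤s (*-monoˡ-≤ k (m≤m+n 2 8))) 10k<n) ⟩
  n ∸ 2 * k            ∎
  where open ≤-Reasoning

-- Rational inequalities between fractions of naturals reduce to ℕ, via the
-- unnormalised rationals (toℚᵘ is an order embedding and a homomorphism).
toℚᵘ-/ : ∀ (i : ℤ) (d : ℕ) .{{_ : NonZero d}} → toℚᵘ (i / d) ℚᵘ.≃ (i ℚᵘ./ d)
toℚᵘ-/ i (suc d) = ℚ.toℚᵘ-fromℚᵘ (ℚᵘ.mkℚᵘ i d)

fraction-≤ : ∀ (a c s D P : ℕ) .{{_ : NonZero s}} .{{_ : NonZero D}} → a * D ≤ c * P →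
             (+ a) / s ≤ℚ (((+ c) / s) *ℚ ((+ 1) / D)) *ℚ ((+ P) / 1)
fraction-≤ a c s@(suc _) D@(suc _) P aD≤cP =
  ℚ.toℚᵘ-cancel-≤ (ℚᵘ.≤-respˡ-≃ (ℚᵘ.≃-sym (toℚᵘ-/ (+ a) s)) (ℚᵘ.≤-respʳ-≃ (ℚᵘ.≃-sym rhs) unnormalised))
  where
  rhs : toℚᵘ ((((+ c) / s) *ℚ ((+ 1) / D)) *ℚ ((+ P) / 1))
        ℚᵘ.≃ (((+ c) ℚᵘ./ s) ℚᵘ.* ((+ 1) ℚᵘ./ D)) ℚᵘ.* ((+ P) ℚᵘ./ 1)
  rhs = ℚᵘ.≃-trans (ℚ.toℚᵘ-homo-* (((+ c) / s) *ℚ ((+ 1) / D)) ((+ P) / 1)) (ℚᵘ.*-cong c/s·1/D (toℚᵘ-/ (+ P) 1))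
    where
    c/s·1/D : toℚᵘ (((+ c) / s) *ℚ ((+ 1) / D)) ℚᵘ.≃ ((+ c) ℚᵘ./ s) ℚᵘ.* ((+ 1) ℚᵘ./ D)
    c/s·1/D = ℚᵘ.≃-trans (ℚ.toℚᵘ-homo-* ((+ c) / s) ((+ 1) / D)) (ℚᵘ.*-cong (toℚᵘ-/ (+ c) s) (toℚᵘ-/ (+ 1) D))
  cross-multiplied : a * (s * D * 1) ≤ c * 1 * P * s
  cross-multiplied rewrite *-identityʳ (s * D) | *-identityʳ c = begin
    a * (s * D)    ≡⟨ reorder a s D ⟩
    s * (a * D)    ≤⟨ *-monoʳ-≤ s aD≤cP ⟩
    s * (c * P)    ≡⟨ *-comm s (c * P) ⟩
    c * P * s      ∎
    where
    open ≤-Reasoning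
    reorder : ∀ a s D → a * (s * D) ≡ s * (a * D)
    reorder = solve-∀
  unnormalised : (+ a) ℚᵘ./ s ℚᵘ.≤ (((+ c) ℚᵘ./ s) ℚᵘ.* ((+ 1) ℚᵘ./ D)) ℚᵘ.* ((+ P) ℚᵘ./ 1)
  unnormalised = ℚᵘ.*≤* (subst₂ ℤ._≤_ (ℤ.pos-* a (s * D * 1)) (sym rhs-numerator) (+≤+ cross-multiplied))
    where
    rhs-numerator : (+ c ℤ.* + 1) ℤ.* + P ℤ.* + s ≡ + (c * 1 * P * s)
    rhs-numerator = trans (cong (ℤ._* + s) (trans (cong (ℤ._* + P) (sym (ℤ.pos-* c 1))) (sym (ℤ.pos-* (c * 1) P))))
                          (sym (ℤ.pos-* (c * 1 * P) s))

≤n/100⇒ : ∀ m n → (+ m) / 1 ≤ℚ ((+ 1) / 100) *ℚ ((+ n) / 1) → 100 * m ≤ n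
≤n/100⇒ m n h with ℚᵘ.≤-respʳ-≃ (ℚᵘ.≃-trans (ℚ.toℚᵘ-homo-* ((+ 1) / 100) ((+ n) / 1))
                                             (ℚᵘ.*-cong (toℚᵘ-/ (+ 1) 100) (toℚᵘ-/ (+ n) 1)))
                                (ℚᵘ.≤-respˡ-≃ (toℚᵘ-/ (+ m) 1) (ℚ.toℚᵘ-mono-≤ h))
... | ℚᵘ.*≤* z = cancel (ℤ.drop‿+≤+ (subst₂ ℤ._≤_ (sym (ℤ.pos-* m (100 * 1)))
                                               (trans (cong (ℤ._* + 1) (sym (ℤ.pos-* 1 n))) (sym (ℤ.pos-* (1 * n) 1))) z))
  where
  cancel : m * (100 * 1) ≤ 1 * n * 1 → 100 * m ≤ n
  cancel p rewrite *-identityʳ (1 * n) | *-identityˡ n = subst (_≤ n) (*-comm m 100) p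

100m≤n : ∀ (α : ℚ) n m → α <ℚ ((+ 1) / 100) → α *ℚ ((+ n) / 1) ≡ (+ m) / 1 → 100 * m ≤ n
100m≤n α n m α<1/100 αn≡m = ≤n/100⇒ m n (subst (_≤ℚ ((+ 1) / 100) *ℚ ((+ n) / 1)) αn≡m
  (ℚ.*-monoʳ-≤-nonNeg ((+ n) / 1) {{ℚ.normalize-nonNeg n 1}} (ℚ.<⇒≤ α<1/100)))

prob-≤ : ∀ {X : Set} (P₀ P : X → Bool) (xs : List X) (D F : ℕ) .{{_ : NonZero D}} →
         length (select P xs) * D ≤ length (select P₀ xs) * F →
         prob P xs ≤ℚ (prob P₀ xs *ℚ ((+ 1) / D)) *ℚ ((+ F) / 1)
prob-≤ P₀ P xs D F counts with length xs
... | zero = subst (0ℚ ≤ℚ_) (sym (trans (cong (_*ℚ ((+ F) / 1)) (ℚ.*-zeroˡ ((+ 1) / D))) (ℚ.*-zeroˡ ((+ F) / 1))))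
                 ℚ.≤-refl
... | suc t = fraction-≤ (length (select P xs)) (length (select P₀ xs)) (suc t) D F counts

-- The theorem.
lemma9 : (α : ℚ) (n m : ℕ) → 0ℚ <ℚ α → α <ℚ ((+ 1) / 100) → α *ℚ ((+ n) / 1) ≡ (+ m) / 1 →
         (k : ℕ) → (A : Subset n) → ∣ A ∣ ≡ 2 * k → 10 * k < n →
         (i b : ℕ) → 2 * i + b ≤ 2 * k →
         q n m A i b ≤ℚ (q n m A i 0 *ℚ inv20^ b) *ℚ pow4 (k ∸ i)
lemma9 α n m _ α<1/100 αn≡m k A |A|≡2k 10k<n i b _ =
  prob-≤ _ _ (matchings n m) (20 ^ b) (4 ^ (k ∸ i)) {{m^n≢0 20 b}} (begin
    c b * 20 ^ b                   ≡⟨ *-comm (c b) (20 ^ b) ⟩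
    20 ^ b * c b                   ≤⟨ iterate-ratio 20 (2 * (k ∸ i)) c ratio b ⟩
    choose (2 * (k ∸ i)) b * c 0   ≤⟨ *-monoˡ-≤ (c 0) (choose≤2^ (2 * (k ∸ i)) b) ⟩
    2 ^ (2 * (k ∸ i)) * c 0        ≡⟨ cong (_* c 0) (^-*-assoc 2 2 (k ∸ i)) ⟨
    4 ^ (k ∸ i) * c 0              ≡⟨ *-comm (4 ^ (k ∸ i)) (c 0) ⟩
    c 0 * 4 ^ (k ∸ i)              ∎)
  where
  open ≤-Reasoning
  open Switching n A using (X; switching)
  c : ℕ → ℕ
  c b′ = length (X m i b′)
  N : ℕ
  N = (n ∸ 2 * k) ∸ 2 * m
  switching′ : ∀ b′ → N * suc b′ * c (suc b′) ≤ 2 * (2 * (k ∸ i) ∸ b′) * m * c b′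
  switching′ b′ = subst₂ (λ a f → ((n ∸ a) ∸ 2 * m) * suc b′ * c (suc b′) ≤ 2 * f * m * c b′)
    |A|≡2k (trans (cong (_∸ (2 * i + b′)) |A|≡2k) (2k∸[2i+b] k i b′)) (switching m i b′)
  100m≤n′ : 100 * m ≤ n
  100m≤n′ = 100m≤n α n m α<1/100 αn≡m
  ratio : ∀ b′ → suc b′ * (20 * c (suc b′)) ≤ (2 * (k ∸ i) ∸ b′) * c b′
  ratio b′ = ratio-bound N (suc b′) (c (suc b′)) (2 * (k ∸ i) ∸ b′) m (c b′) (switching′ b′)
    (40m≤N n m k 100m≤n′ 10k<n) (1≤N n m k 100m≤n′ 10k<n)
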